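{- For all $d,n\in\mathbb{N}$, $r(d,\mathbb{F}_3^n)\ge n+1$, with equality if $n\le d$.
   Context: $\mathbb{F}_3^n$ denotes $n$-dimensional affine space over the field with three elements. A $k$-dimensional flat is a $k$-dimensional affine subspace. For $d\in\mathbb{N}$, a subset $C\subseteq\mathbb{F}_3^n$ is a $d$-cap if, for each $k=1,\dots,d$, no $k+2$ points of $C$ lie on a $k$-dimensional flat (equivalently, every subset of $C$ of size at most $d+2$ is affinely independent). $r(d,\mathbb{F}_3^n)$ denotes the largest cardinality of a $d$-cap in $\mathbb{F}_3^n$. -}

module Defs where

open import Data.Nat using (ℕ; zero; suc; _≤_)
import Data.Nat as ℕ
open import Data.Nat.DivMod using (_mod_)
open import Data.Fin using (Fin; toℕ; zero; suc)
open import Data.Fin.Subset using (Subset; _∉_; ∣_∣)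
open import Data.Product using (_×_)
open import Function.Definitions using (Injective)
open import Relation.Binary.PropositionalEquality using (_≡_)

F₃ : Set
F₃ = Fin 3

infixl 6 _+₃_
infixl 7 _*₃_

_+₃_ : F₃ → F₃ → F₃
a +₃ b = (toℕ a ℕ.+ toℕ b) mod 3

_*₃_ : F₃ → F₃ → F₃
a *₃ b = (toℕ a ℕ.* toℕ b) mod 3

0₃ : F₃
0₃ = zero

Σ₃ : ∀ {m} → (Fin m → F₃) → F₃
Σ₃ {zero}  f = 0₃
Σ₃ {suc m} f = f zero +₃ Σ₃ (λ i → f (suc i))

Point : ℕ → Set
Point n = Fin n → F₃

AffIndepOn : ∀ {n m} → (Fin m → Point n) → Subset m → Set
AffIndepOn {n} {m} P S =
  (λ′ : Fin m → F₃) →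
  (∀ i → i ∉ S → λ′ i ≡ 0₃) →
  Σ₃ λ′ ≡ 0₃ →
  (∀ (j : Fin n) → Σ₃ (λ i → λ′ i *₃ P i j) ≡ 0₃) →
  ∀ i → λ′ i ≡ 0₃

IsCap : (d : ℕ) → ∀ {n m} → (Fin m → Point n) → Set
IsCap d {n} {m} P =
  Injective _≡_ _≡_ P × (∀ (S : Subset m) → ∣ S ∣ ≤ suc (suc d) → AffIndepOn P S)

-- The points 0, e₁, …, eₙ of F₃ⁿ are affinely independent, so they form a
-- d-cap for every d.  Conversely, an affine dependence Σ λᵢ Pᵢ = 0,
-- Σ λᵢ = 0 among n+2 points is a nontrivial solution of n+1 homogeneous
-- linear equations in n+2 unknowns, which Gaussian elimination provides.
-- When n ≤ d those n+2 points form a subset of size at most d+2, so no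
-- d-cap has more than n+1 points.
module Submission where

open import Defs
open import Relation.Binary.PropositionalEquality
  using (_≡_; _≢_; refl; sym; trans; cong; cong₂; cong-app; subst; isEquivalence;
         module ≡-Reasoning)
open import Algebra.Bundles using (CommutativeSemiring)
open import Algebra.Definitions {A = F₃} _≡_
  using (Associative; Commutative; LeftIdentity; LeftZero; _DistributesOverʳ_)
open import Algebra.Structures {A = F₃} _≡_ using (IsCommutativeMonoid)
open import Algebra.Structures.Biased {A = F₃} _≡_
  using (isCommutativeMonoidˡ; isCommutativeSemiringˡ)
open import Data.Empty using (⊥-elim)
open import Data.Fin using (Fin; zero; suc; punchIn; _↑ˡ_)
open import Data.Fin.Patterns using (0F; 1F; 2F)
open import Data.Fin.Properties using (all?; ¬∀⟶∃¬; punchInᵢ≢i; _≟_)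
open import Data.Fin.Subset using (Subset; _∉_; ∣_∣; ⊤; ⊥)
open import Data.Fin.Subset.Properties using (∣⊥∣≡0)
open import Data.Nat using (ℕ; zero; suc; _+_; _≤_; _<_; s≤s; _≤?_)
open import Data.Nat.Properties using (≤-refl; ≰⇒>; m<n⇒m<1+n; m≤n⇒∃[o]m+o≡n)
open import Data.Product using (Σ; _×_; _,_; ∃-syntax)
open import Data.Vec using (_++_; here; there)
open import Data.Vec.Functional using (Vector; _∷_; insertAt; removeAt)
open import Data.Vec.Functional.Properties using (insertAt-lookup; insertAt-punchIn)
open import Function using (_∘_)
open import Function.Definitions using (Injective)
open import Level using (0ℓ)
open import Relation.Nullary using (¬_; yes; no)
open import Relation.Nullary.Decidable using (from-yes; ¬?; _→-dec_)

open ≡-Reasoning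

1₃ : F₃
1₃ = 1F

-₃_ : F₃ → F₃
-₃ 0F = 0F
-₃ 1F = 2F
-₃ 2F = 1F

+₃-assoc : Associative _+₃_
+₃-assoc = from-yes (all? λ x → all? λ y → all? λ z → x +₃ y +₃ z ≟ x +₃ (y +₃ z))

+₃-comm : Commutative _+₃_
+₃-comm = from-yes (all? λ x → all? λ y → x +₃ y ≟ y +₃ x)

+₃-identityˡ : LeftIdentity 0₃ _+₃_
+₃-identityˡ = from-yes (all? λ x → 0₃ +₃ x ≟ x)

*₃-assoc : Associative _*₃_
*₃-assoc = from-yes (all? λ x → all? λ y → all? λ z → x *₃ y *₃ z ≟ x *₃ (y *₃ z))

*₃-comm : Commutative _*₃_
*₃-comm = from-yes (all? λ x → all? λ y → x *₃ y ≟ y *₃ x)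

*₃-identityˡ : LeftIdentity 1₃ _*₃_
*₃-identityˡ = from-yes (all? λ x → 1₃ *₃ x ≟ x)

*₃-zeroˡ : LeftZero 0₃ _*₃_
*₃-zeroˡ = from-yes (all? λ x → 0₃ *₃ x ≟ 0₃)

*₃-distribʳ-+₃ : _*₃_ DistributesOverʳ _+₃_
*₃-distribʳ-+₃ = from-yes (all? λ x → all? λ y → all? λ z → (y +₃ z) *₃ x ≟ y *₃ x +₃ z *₃ x)

*₃-distribˡ-+₃-scaled : ∀ x b a s → x *₃ (b +₃ s *₃ a) ≡ x *₃ b +₃ s *₃ (x *₃ a)
*₃-distribˡ-+₃-scaled = from-yes (all? λ x → all? λ b → all? λ a → all? λ s →
  x *₃ (b +₃ s *₃ a) ≟ x *₃ b +₃ s *₃ (x *₃ a))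

-- A nonzero a ∈ F₃ is its own inverse.
pivot-cancel : ∀ a t → a ≢ 0₃ → -₃ (a *₃ t) *₃ a +₃ t ≡ 0₃
pivot-cancel = from-yes (all? λ a → all? λ t → ¬? (a ≟ 0₃) →-dec (-₃ (a *₃ t) *₃ a +₃ t ≟ 0₃))

multiplier-swap : ∀ a t u s → -₃ (a *₃ t) *₃ u +₃ s ≡ s +₃ -₃ (u *₃ a) *₃ t
multiplier-swap = from-yes (all? λ a → all? λ t → all? λ u → all? λ s →
  -₃ (a *₃ t) *₃ u +₃ s ≟ s +₃ -₃ (u *₃ a) *₃ t)

isCommutativeMonoid₃ : ∀ _∙_ ε → Associative _∙_ → LeftIdentity ε _∙_ → Commutative _∙_ →
                       IsCommutativeMonoid _∙_ ε
isCommutativeMonoid₃ _∙_ ε assoc identityˡ comm = isCommutativeMonoidˡ record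
  { isSemigroup = record
    { isMagma = record { isEquivalence = isEquivalence ; ∙-cong = cong₂ _∙_ }
    ; assoc   = assoc
    }
  ; identityˡ = identityˡ
  ; comm      = comm
  }

F₃-commutativeSemiring : CommutativeSemiring 0ℓ 0ℓ
F₃-commutativeSemiring = record
  { isCommutativeSemiring = isCommutativeSemiringˡ record
    { +-isCommutativeMonoid = isCommutativeMonoid₃ _+₃_ 0₃ +₃-assoc +₃-identityˡ +₃-comm
    ; *-isCommutativeMonoid = isCommutativeMonoid₃ _*₃_ 1₃ *₃-assoc *₃-identityˡ *₃-comm
    ; distribʳ              = *₃-distribʳ-+₃
    ; zeroˡ                 = *₃-zeroˡ
    }
  }

open CommutativeSemiring F₃-commutativeSemiring using (semiring; zeroʳ; *-identityʳ; +-identityʳ)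
open import Algebra.Properties.Semiring.Sum semiring
  using (sum; sum-cong-≗; sum-remove; sum-replicate-zero; ∑-distrib-+; *-distribˡ-sum)

Σ₃≡sum : ∀ {m} (f : Vector F₃ m) → Σ₃ f ≡ sum f
Σ₃≡sum {zero}  f = refl
Σ₃≡sum {suc m} f = cong (f zero +₃_) (Σ₃≡sum (f ∘ suc))

sum-≡0 : ∀ {m} {f : Vector F₃ m} → (∀ i → f i ≡ 0₃) → sum f ≡ 0₃
sum-≡0 {m} f≡0 = trans (sum-cong-≗ f≡0) (sum-replicate-zero m)

infix 7 _·_

_·_ : ∀ {m} → Vector F₃ m → Vector F₃ m → F₃
x · a = sum (λ i → x i *₃ a i)

·-zeroʳ : ∀ {m} (x : Vector F₃ m) {a : Vector F₃ m} → (∀ i → a i ≡ 0₃) → x · a ≡ 0₃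
·-zeroʳ x a≡0 = sum-≡0 λ i → trans (cong (x i *₃_) (a≡0 i)) (zeroʳ (x i))

·-distrib-scaled : ∀ {m} (x b a : Vector F₃ m) s →
                   x · (λ i → b i +₃ s *₃ a i) ≡ x · b +₃ s *₃ (x · a)
·-distrib-scaled x b a s = begin
  x · (λ i → b i +₃ s *₃ a i)
    ≡⟨ sum-cong-≗ (λ i → *₃-distribˡ-+₃-scaled (x i) (b i) (a i) s) ⟩
  sum (λ i → x i *₃ b i +₃ s *₃ (x i *₃ a i))
    ≡⟨ ∑-distrib-+ (λ i → x i *₃ b i) _ ⟩
  x · b +₃ sum (λ i → s *₃ (x i *₃ a i))
    ≡⟨ cong (x · b +₃_) (sym (*-distribˡ-sum s (λ i → x i *₃ a i))) ⟩
  x · b +₃ s *₃ (x · a)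
    ∎

·-insertAt : ∀ {m} (μ : Vector F₃ m) c t (a : Vector F₃ (suc m)) →
             insertAt μ c t · a ≡ t *₃ a c +₃ μ · removeAt a c
·-insertAt μ c t a = trans (sum-remove {i = c} (λ j → insertAt μ c t j *₃ a j))
  (cong₂ _+₃_ (cong (_*₃ a c) (insertAt-lookup μ c t))
              (sum-cong-≗ λ i → cong (_*₃ a (punchIn c i)) (insertAt-punchIn μ c t i)))

NontrivialSolution : ∀ {k m} → (Fin k → Vector F₃ m) → Set
NontrivialSolution A = ∃[ x ] (∃[ i ] x i ≢ 0₃) × (∀ r → x · A r ≡ 0₃)

-- Subtract from b the multiple of the pivot row a that kills column c, and
-- drop that column; the multiplier b c / a c is b c * a c since a c ≠ 0.
eliminate : ∀ {m} (c : Fin (suc m)) (a b : Vector F₃ (suc m)) → Vector F₃ m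
eliminate c a b i = b (punchIn c i) +₃ -₃ (b c *₃ a c) *₃ a (punchIn c i)

eliminate-solution : ∀ {k m} (A : Fin (suc k) → Vector F₃ (suc m)) c → A zero c ≢ 0₃ →
                     NontrivialSolution (λ r → eliminate c (A zero) (A (suc r))) →
                     NontrivialSolution A
eliminate-solution A c ac≢0 (μ , (i , μi≢0) , μ⊥B) = x , (punchIn c i , xi≢0) , x⊥A
  where
  a = A zero
  t = μ · removeAt a c
  x = insertAt μ c (-₃ (a c *₃ t))

  xi≢0 : x (punchIn c i) ≢ 0₃
  xi≢0 = μi≢0 ∘ trans (sym (insertAt-punchIn μ c _ i))

  x⊥A : ∀ r → x · A r ≡ 0₃
  x⊥A zero    = trans (·-insertAt μ c _ a) (pivot-cancel (a c) t ac≢0)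
  x⊥A (suc r) = begin
    x · b                                      ≡⟨ ·-insertAt μ c _ b ⟩
    -₃ (a c *₃ t) *₃ b c +₃ μ · removeAt b c   ≡⟨ multiplier-swap (a c) t (b c) _ ⟩
    μ · removeAt b c +₃ -₃ (b c *₃ a c) *₃ t
      ≡⟨ sym (·-distrib-scaled μ (removeAt b c) (removeAt a c) (-₃ (b c *₃ a c))) ⟩
    μ · eliminate c a b                        ≡⟨ μ⊥B r ⟩
    0₃                                         ∎
    where b = A (suc r)

underdetermined⇒nontrivialSolution : ∀ {k m} → k < m → (A : Fin k → Vector F₃ m) →
                                     NontrivialSolution A
underdetermined⇒nontrivialSolution {zero}  {suc m} _ A = (λ _ → 1₃) , (zero , λ ()) , λ ()
underdetermined⇒nontrivialSolution {suc k} {suc m} (s≤s k<m) A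
  with all? (λ i → A zero i ≟ 0₃)
... | yes a≡0 with underdetermined⇒nontrivialSolution (m<n⇒m<1+n k<m) (A ∘ suc)
...   | x , x≢0 , x⊥ = x , x≢0 , λ { zero → ·-zeroʳ x a≡0 ; (suc r) → x⊥ r }
underdetermined⇒nontrivialSolution {suc k} {suc m} (s≤s k<m) A
    | no a≢0 with ¬∀⟶∃¬ (suc m) _ (λ i → A zero i ≟ 0₃) a≢0
...   | c , ac≢0 = eliminate-solution A c ac≢0
                     (underdetermined⇒nontrivialSolution k<m (λ r → eliminate c (A zero) (A (suc r))))

δ : ∀ {n} → Fin n → Fin n → F₃
δ zero    zero    = 1₃
δ zero    (suc _) = 0₃
δ (suc _) zero    = 0₃
δ (suc i) (suc j) = δ i j

δ-diag : ∀ {n} (i : Fin n) → δ i i ≡ 1₃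
δ-diag zero    = refl
δ-diag (suc i) = δ-diag i

δ-offdiag : ∀ {n} {i j : Fin n} → i ≢ j → δ i j ≡ 0₃
δ-offdiag {i = zero}  {zero}  i≢j = ⊥-elim (i≢j refl)
δ-offdiag {i = zero}  {suc j} _   = refl
δ-offdiag {i = suc i} {zero}  _   = refl
δ-offdiag {i = suc i} {suc j} i≢j = δ-offdiag (i≢j ∘ cong suc)

·-δ : ∀ {n} (g : Vector F₃ n) j → g · (λ i → δ i j) ≡ g j
·-δ {suc n} g j = begin
  g · (λ i → δ i j)                                    ≡⟨ sum-remove {i = j} (λ i → g i *₃ δ i j) ⟩
  g j *₃ δ j j +₃ sum (λ i → g (punchIn j i) *₃ δ (punchIn j i) j)
    ≡⟨ cong₂ _+₃_ (trans (cong (g j *₃_) (δ-diag j)) (*-identityʳ (g j)))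
                  (·-zeroʳ (g ∘ punchIn j) (λ i → δ-offdiag (punchInᵢ≢i j i))) ⟩
  g j +₃ 0₃                                            ≡⟨ +-identityʳ (g j) ⟩
  g j                                                  ∎

simplex : ∀ n → Fin (suc n) → Point n
simplex n zero    = λ _ → 0₃
simplex n (suc i) = δ i

simplex-injective : ∀ n → Injective _≡_ _≡_ (simplex n)
simplex-injective n {zero}  {zero}  _ = refl
simplex-injective n {zero}  {suc j} e with () ← trans (cong-app e j) (δ-diag j)
simplex-injective n {suc i} {zero}  e with () ← trans (sym (cong-app e i)) (δ-diag i)
simplex-injective n {suc i} {suc j} e with i ≟ j
... | yes i≡j = cong suc i≡j
... | no  i≢j with () ← trans (sym (δ-offdiag i≢j)) (trans (cong-app e j) (δ-diag j))

simplex-affinelyIndependent : ∀ n S → AffIndepOn (simplex n) S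
simplex-affinelyIndependent n S λ′ _ Σλ′≡0 coords = λ′≡0
  where
  λ′-suc≡0 : ∀ j → λ′ (suc j) ≡ 0₃
  λ′-suc≡0 j = begin
    λ′ (suc j)                            ≡⟨ sym (·-δ (λ′ ∘ suc) j) ⟩
    (λ′ ∘ suc) · (λ i → δ i j)            ≡⟨ sym (Σ₃≡sum rest) ⟩
    Σ₃ rest                               ≡⟨ sym (+₃-identityˡ _) ⟩
    0₃ +₃ Σ₃ rest                         ≡⟨ cong (_+₃ Σ₃ rest) (sym (zeroʳ (λ′ zero))) ⟩
    Σ₃ (λ i → λ′ i *₃ simplex n i j)      ≡⟨ coords j ⟩
    0₃                                    ∎
    where
    rest : Vector F₃ n
    rest i = λ′ (suc i) *₃ δ i j

  Σtail≡0 : Σ₃ (λ′ ∘ suc) ≡ 0₃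
  Σtail≡0 = trans (Σ₃≡sum (λ′ ∘ suc)) (sum-≡0 λ′-suc≡0)

  λ′≡0 : ∀ i → λ′ i ≡ 0₃
  λ′≡0 zero = begin
    λ′ zero                          ≡⟨ sym (+-identityʳ _) ⟩
    λ′ zero +₃ 0₃                    ≡⟨ cong (λ′ zero +₃_) (sym Σtail≡0) ⟩
    Σ₃ λ′                            ≡⟨ Σλ′≡0 ⟩
    0₃                               ∎
  λ′≡0 (suc j) = λ′-suc≡0 j

simplex-isCap : ∀ d n → IsCap d (simplex n)
simplex-isCap d n = simplex-injective n , λ S _ → simplex-affinelyIndependent n S

-- x solves this system iff it is an affine dependence of the points P i:
-- row 0 says Σ xᵢ = 0 and row j+1 is coordinate j of Σ xᵢ Pᵢ = 0.
affineConditions : ∀ {n m} → (Fin m → Point n) → Fin (suc n) → Vector F₃ m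
affineConditions P r i = (1₃ ∷ P i) r

AffIndepOn⇒trivialSolution : ∀ {n m} {P : Fin m → Point n} {S : Subset m} → AffIndepOn P S →
                             (x : Vector F₃ m) → (∀ i → i ∉ S → x i ≡ 0₃) →
                             (∀ r → x · affineConditions P r ≡ 0₃) → ∀ i → x i ≡ 0₃
AffIndepOn⇒trivialSolution {P = P} indep x x∉S≡0 x⊥ =
  indep x x∉S≡0 Σx≡0 (λ j → trans (Σ₃≡sum (λ i → x i *₃ P i j)) (x⊥ (suc j)))
  where
  Σx≡0 : Σ₃ x ≡ 0₃
  Σx≡0 = begin
    Σ₃ x              ≡⟨ Σ₃≡sum x ⟩
    sum x             ≡⟨ sum-cong-≗ (sym ∘ *-identityʳ ∘ x) ⟩
    x · (λ _ → 1₃)    ≡⟨ x⊥ zero ⟩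
    0₃                ∎

padZero : ∀ {a} b → Vector F₃ a → Vector F₃ (a + b)
padZero {zero}  b x i       = 0₃
padZero {suc a} b x zero    = x zero
padZero {suc a} b x (suc i) = padZero b (x ∘ suc) i

padZero-↑ˡ : ∀ {a} b (x : Vector F₃ a) i → padZero b x (i ↑ˡ b) ≡ x i
padZero-↑ˡ b x zero    = refl
padZero-↑ˡ b x (suc i) = padZero-↑ˡ b (x ∘ suc) i

padZero-∉ : ∀ {a} b (x : Vector F₃ a) i → i ∉ ⊤ {a} ++ ⊥ {b} → padZero b x i ≡ 0₃
padZero-∉ {zero}  b x i       _   = refl
padZero-∉ {suc a} b x zero    i∉S = ⊥-elim (i∉S here)
padZero-∉ {suc a} b x (suc i) i∉S = padZero-∉ b (x ∘ suc) i (i∉S ∘ there)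

·-padZero : ∀ {a} b (x : Vector F₃ a) (y : Vector F₃ (a + b)) →
            padZero b x · y ≡ x · (y ∘ (_↑ˡ b))
·-padZero {zero}  b x y = sum-≡0 (λ i → *₃-zeroˡ (y i))
·-padZero {suc a} b x y = cong (x zero *₃ y zero +₃_) (·-padZero b (x ∘ suc) (y ∘ suc))

∣⊤++⊥∣ : ∀ a b → ∣ ⊤ {a} ++ ⊥ {b} ∣ ≡ a
∣⊤++⊥∣ zero    b = ∣⊥∣≡0 b
∣⊤++⊥∣ (suc a) b = cong suc (∣⊤++⊥∣ a b)

¬AffIndepOn-⊤++⊥ : ∀ {n k} (P : Fin (suc (suc n) + k) → Point n) →
                   ¬ AffIndepOn P (⊤ {suc (suc n)} ++ ⊥ {k})
¬AffIndepOn-⊤++⊥ {n} {k} P indep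
  with underdetermined⇒nontrivialSolution ≤-refl (affineConditions (P ∘ (_↑ˡ k)))
... | μ , (i , μi≢0) , μ⊥ = μi≢0 (trans (sym (padZero-↑ˡ k μ i)) (x≡0 (i ↑ˡ k)))
  where
  x≡0 : ∀ i → padZero k μ i ≡ 0₃
  x≡0 = AffIndepOn⇒trivialSolution {P = P} indep (padZero k μ) (padZero-∉ k μ)
          (λ r → trans (·-padZero k μ (affineConditions P r)) (μ⊥ r))

IsCap⇒size≤1+dim : ∀ {d n m} → n ≤ d → (P : Fin m → Point n) → IsCap d P → m ≤ suc n
IsCap⇒size≤1+dim {d} {n} {m} n≤d P (_ , cap) with m ≤? suc n
... | yes m≤1+n = m≤1+n
... | no  m≰1+n with k , refl ← m≤n⇒∃[o]m+o≡n (≰⇒> m≰1+n) =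
  ⊥-elim (¬AffIndepOn-⊤++⊥ P (cap (⊤ {suc (suc n)} ++ ⊥ {k}) |S|≤d+2))
  where
  |S|≤d+2 : ∣ ⊤ {suc (suc n)} ++ ⊥ {k} ∣ ≤ suc (suc d)
  |S|≤d+2 = subst (_≤ suc (suc d)) (sym (∣⊤++⊥∣ (suc (suc n)) k)) (s≤s (s≤s n≤d))

lemma2p2 : (d n : ℕ) →
    Σ (Fin (suc n) → Point n) (λ P → IsCap d P)
    × (n ≤ d → ∀ (m : ℕ) (P : Fin m → Point n) → IsCap d P → m ≤ suc n)
lemma2p2 d n = (simplex n , simplex-isCap d n) , λ n≤d m → IsCap⇒size≤1+dim n≤d
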